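{- Let $\mathcal{F}r$ be a finite set of frame axioms and let $LS_g[\mathcal{F}r]$ be the calculus $LS$ extended with the structural rule synthesised from each axiom of $\mathcal{F}r$. If a formula $F$ is not provable in $LS_g[\mathcal{F}r]$ (i.e. for a label $w\neq\epsilon$ the sequent $\emptyset;\emptyset\vdash w:F$ has no derivation), then $F$ is not valid in the Kripke relational models whose frames satisfy every axiom in $\mathcal{F}r$.
   Context: Formulae: built from propositional variables $p$ (countable set $Var$) and constants $\top,\bot,\top^*$ using $\land,\to,*,-\!*$. Labels: countably infinite set $\mathcal{L}$ with distinguished label $\epsilon$. Relational atoms: $(a,b\triangleright c)$, $a=b$, $a\neq b$ for labels $a,b,c$. Labelled formula: $a:A$. A sequent $\mathcal{G};\Gamma\vdash\Delta$ has a finite set $\mathcal{G}$ of relational atoms and finite sets $\Gamma,\Delta$ of labelled formulae (commas denote union). $E(\mathcal{G})\vdash a=b$ holds iff $(a,b)$ is in the smallest equivalence relation on $\mathcal{L}$ containing all $(c,d)$ with $c=d\in\mathcal{G}$. The calculus $LS$ (no cut rule) has rules (from premises infer conclusion): zero-premise rules $(id)$ $\mathcal{G};\Gamma,a:p\vdash b:p,\Delta$ if $E(\mathcal{G})\vdash a=b$ ($p$ a propositional variable); $(\bot L)$ $\mathcal{G};\Gamma,a:\bot\vdash\Delta$; $(\top R)$ $\mathcal{G};\Gamma\vdash a:\top,\Delta$; $(\top^*R)$ $\mathcal{G};\Gamma\vdash a:\top^*,\Delta$ if $E(\mathcal{G})\vdash a=\epsilon$; $(NEq)$ $\mathcal{G};\Gamma\vdash\Delta$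 if $a\neq b\in\mathcal{G}$ and $E(\mathcal{G})\vdash a=b$. $(\top^*L)$: from $\mathcal{G}\cup\{a=\epsilon\};\Gamma\vdash\Delta$ infer $\mathcal{G};\Gamma,a:\top^*\vdash\Delta$. $(\land L)$: from $\mathcal{G};\Gamma,a:A,a:B\vdash\Delta$ infer $\mathcal{G};\Gamma,a:A\land B\vdash\Delta$. $(\land R)$: from $\mathcal{G};\Gamma\vdash a:A,\Delta$ and $\mathcal{G};\Gamma\vdash a:B,\Delta$ infer $\mathcal{G};\Gamma\vdash a:A\land B,\Delta$. $(\to L)$: from $\mathcal{G};\Gamma\vdash a:A,\Delta$ and $\mathcal{G};\Gamma,a:B\vdash\Delta$ infer $\mathcal{G};\Gamma,a:A\to B\vdash\Delta$. $(\to R)$: from $\mathcal{G};\Gamma,a:A\vdash a:B,\Delta$ infer $\mathcal{G};\Gamma\vdash a:A\to B,\Delta$. $(*L)$: from $\mathcal{G}\cup\{(x,y\triangleright z)\};\Gamma,x:A,y:B\vdash\Delta$ infer $\mathcal{G};\Gamma,z:A*B\vdash\Delta$, where $x,y$ are distinct labels, not $\epsilon$, not occurring in the conclusion. $(-\!*R)$: from $\mathcal{G}\cup\{(x,z\triangleright y)\};\Gamma,x:A\vdash y:B,\Delta$ infer $\mathcal{G};\Gamma\vdash z:A-\!*B,\Delta$, same freshness condition. $(*R)$: if $(x,y\triangleright z)\in\mathcal{G}$ and $E(\mathcal{G})\vdash z=w$, from $\mathcal{G};\Gamma\vdash x:A,w:A*B,\Delta$ and $\mathcal{G};\Gamma\vdash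 y:B,w:A*B,\Delta$ infer $\mathcal{G};\Gamma\vdash w:A*B,\Delta$. $(-\!*L)$: if $(x,w\triangleright y)\in\mathcal{G}$ and $E(\mathcal{G})\vdash z=w$, from $\mathcal{G};\Gamma,z:A-\!*B\vdash x:A,\Delta$ and $\mathcal{G};\Gamma,z:A-\!*B,y:B\vdash\Delta$ infer $\mathcal{G};\Gamma,z:A-\!*B\vdash\Delta$. $(EM)$: from $\mathcal{G}\cup\{a=b\};\Gamma\vdash\Delta$ and $\mathcal{G}\cup\{a\neq b\};\Gamma\vdash\Delta$ infer $\mathcal{G};\Gamma\vdash\Delta$. A frame axiom is a first-order sentence over constant $\epsilon$, ternary relation $\triangleright$ and equality of the form $\forall x_1..x_m.(s_1=t_1\&\cdots\& s_p=t_p\& S_1\&\cdots\& S_k\Rightarrow\exists y_1..y_n.(T_1\&\cdots\& T_l))$ where $s_i,t_i\in\{x_1,..,x_m,\epsilon\}$; each $S_i$ is a ternary atom $(x_u,x_v\triangleright x_w)$ or a disequality between members of $\{x_1,..,x_m,\epsilon\}$; $\epsilon$ does not occur in ternary $S_i$ and each variable occurs at most once altogether in $S_1..S_k$; each $T_i$ is a ternary atom, equality or disequality over $x$'s, $y$'s and $\epsilon$. Its synthesised structural rule: for any substitution $\theta$ of labels for $x_1..x_m$ (fixing $\epsilon$) with $S_i\theta\in\mathcal{G}$ for all $i$ and $E(\mathcal{G})\vdash s_i\theta=t_i\theta$ for all $i$, and distinct labels $b_1..b_n\neq\epsilon$ not occurring in the conclusion, with $\sigma=[b_1/y_1,..,b_n/y_n]$: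 from $\mathcal{G}\cup\{T_1\theta\sigma,..,T_l\theta\sigma\};\Gamma\vdash\Delta$ infer $\mathcal{G};\Gamma\vdash\Delta$. A derivation is a finite tree of rule instances whose leaves are zero-premise rules. Semantics: a Kripke relational frame is $(H,R,\epsilon_H)$ with $R\subseteq H^3$, $\epsilon_H\in H$; it satisfies a frame axiom if the sentence is true with $\triangleright:=R$, $\epsilon:=\epsilon_H$, $=$ identity. A model adds $v:Var\to\mathcal{P}(H)$; $h\Vdash p$ iff $h\in v(p)$; $\top$ always, $\bot$ never; $h\Vdash\top^*$ iff $h=\epsilon_H$; $\land,\to$ classical; $h\Vdash A*B$ iff $\exists h_1,h_2$ with $R(h_1,h_2,h)$, $h_1\Vdash A$, $h_2\Vdash B$; $h\Vdash A-\!*B$ iff for all $h_1,h_2$ with $R(h_1,h,h_2)$ and $h_1\Vdash A$, $h_2\Vdash B$. $F$ is valid in a class of models iff it is forced at every world of every model in the class. -}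

module Defs where

open import Level using (0ℓ)
open import Data.Nat using (ℕ; zero)
open import Data.Fin using (Fin)
open import Data.List using (List; []; _∷_; _++_; map; concatMap)
open import Data.List.Membership.Propositional using (_∈_)
open import Data.List.Relation.Unary.All using (All)
open import Data.List.Relation.Unary.Any using (Any)
open import Data.List.Relation.Unary.Unique.Propositional using (Unique)
open import Data.Product using (Σ; _×_; proj₁; proj₂)
open import Data.Sum using (_⊎_)
open import Data.Empty using (⊥)
open import Data.Unit using (⊤)
open import Relation.Nullary using (¬_)
open import Relation.Binary.PropositionalEquality using (_≡_; _≢_)

Var : Set
Var = ℕ

infixr 6 _∧_
infixr 5 _⇒_
infixr 7 _✶_
infixr 5 _-✶_

data Formula : Set where
  var  : Var → Formula
  ⊤ᶠ   : Formula
  ⊥ᶠ   : Formula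
  ⊤*   : Formula
  _∧_  : Formula → Formula → Formula
  _⇒_  : Formula → Formula → Formula
  _✶_  : Formula → Formula → Formula
  _-✶_ : Formula → Formula → Formula

Label : Set
Label = ℕ

ε : Label
ε = zero

data RelAtom : Set where
  ⟨_,_▷_⟩ : Label → Label → Label → RelAtom
  _≐_     : Label → Label → RelAtom
  _≭_     : Label → Label → RelAtom

infix 4 _∶_
record LFormula : Set where
  constructor _∶_
  field
    lab  : Label
    form : Formula
open LFormula public

-- Finite sets are represented by lists, identified up to having the
-- same members (see the rule `set-eq` below).
_≋_ : {A : Set} → List A → List A → Set
xs ≋ ys = ∀ z → (z ∈ xs → z ∈ ys) × (z ∈ ys → z ∈ xs)

data E⊢ (G : List RelAtom) : Label → Label → Set where
  base  : ∀ {a b} → (a ≐ b) ∈ G → E⊢ G a b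
  refl  : ∀ {a} → E⊢ G a a
  sym   : ∀ {a b} → E⊢ G a b → E⊢ G b a
  trans : ∀ {a b c} → E⊢ G a b → E⊢ G b c → E⊢ G a c

OccRA : Label → RelAtom → Set
OccRA l ⟨ a , b ▷ c ⟩ = l ≡ a ⊎ l ≡ b ⊎ l ≡ c
OccRA l (a ≐ b) = l ≡ a ⊎ l ≡ b
OccRA l (a ≭ b) = l ≡ a ⊎ l ≡ b

Occurs : Label → List RelAtom → List LFormula → List LFormula → Set
Occurs l G Γ Δ = Any (OccRA l) G ⊎ Any (λ φ → l ≡ lab φ) Γ ⊎ Any (λ φ → l ≡ lab φ) Δ

Fresh : Label → List RelAtom → List LFormula → List LFormula → Set
Fresh l G Γ Δ = ¬ (l ≡ ε) × ¬ Occurs l G Γ Δ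

-- Frame axioms
--   ∀ x₁..xₘ. (s₁=t₁ & … & sₚ=tₚ & S₁ & … & Sₖ ⇒ ∃ y₁..yₙ. (T₁ & … & Tₗ))

data XT (m : ℕ) : Set where
  x   : Fin m → XT m
  eps : XT m

data Ante (m : ℕ) : Set where
  tri : Fin m → Fin m → Fin m → Ante m
  neq : XT m → XT m → Ante m

data YT (m n : ℕ) : Set where
  x   : Fin m → YT m n
  y   : Fin n → YT m n
  eps : YT m n

data Cons (m n : ℕ) : Set where
  tri : YT m n → YT m n → YT m n → Cons m n
  eq  : YT m n → YT m n → Cons m n
  neq : YT m n → YT m n → Cons m n

xtVars : ∀ {m} → XT m → List (Fin m)
xtVars (x i) = i ∷ []
xtVars eps   = []

anteVars : ∀ {m} → Ante m → List (Fin m)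
anteVars (tri u v w) = u ∷ v ∷ w ∷ []
anteVars (neq s t)   = xtVars s ++ xtVars t

record FrameAxiom : Set where
  field
    m     : ℕ
    n     : ℕ
    eqs   : List (XT m × XT m)
    ante  : List (Ante m)
    cons  : List (Cons m n)
    linear : Unique (concatMap anteVars ante)

module _ {m n : ℕ} (θ : Fin m → Label) (σ : Fin n → Label) where
  instX : XT m → Label
  instX (x i) = θ i
  instX eps   = ε

  instA : Ante m → RelAtom
  instA (tri u v w) = ⟨ θ u , θ v ▷ θ w ⟩
  instA (neq s t)   = instX s ≭ instX t

  instY : YT m n → Label
  instY (x i) = θ i
  instY (y j) = σ j
  instY eps   = ε

  instC : Cons m n → RelAtom
  instC (tri a b c) = ⟨ instY a , instY b ▷ instY c ⟩
  instC (eq a b)    = instY a ≐ instY b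
  instC (neq a b)   = instY a ≭ instY b

-- The calculus LS_g[Fr]  (sequent  G ; Γ ⊢ Δ  is  Der Fr G Γ Δ)

data Der (Fr : List FrameAxiom) : List RelAtom → List LFormula → List LFormula → Set where
  -- sequents are sets: lists with the same members denote the same sequent
  set-eq : ∀ {G G' Γ Γ' Δ Δ'} → G ≋ G' → Γ ≋ Γ' → Δ ≋ Δ' →
           Der Fr G Γ Δ → Der Fr G' Γ' Δ'
  id   : ∀ {G Γ Δ a b p} → E⊢ G a b →
         Der Fr G ((a ∶ var p) ∷ Γ) ((b ∶ var p) ∷ Δ)
  ⊥L   : ∀ {G Γ Δ a} → Der Fr G ((a ∶ ⊥ᶠ) ∷ Γ) Δ
  ⊤R   : ∀ {G Γ Δ a} → Der Fr G Γ ((a ∶ ⊤ᶠ) ∷ Δ)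
  ⊤*R  : ∀ {G Γ Δ a} → E⊢ G a ε → Der Fr G Γ ((a ∶ ⊤*) ∷ Δ)
  NEq  : ∀ {G Γ Δ a b} → (a ≭ b) ∈ G → E⊢ G a b → Der Fr G Γ Δ
  ⊤*L  : ∀ {G Γ Δ a} → Der Fr ((a ≐ ε) ∷ G) Γ Δ → Der Fr G ((a ∶ ⊤*) ∷ Γ) Δ
  ∧L   : ∀ {G Γ Δ a A B} → Der Fr G ((a ∶ A) ∷ (a ∶ B) ∷ Γ) Δ →
         Der Fr G ((a ∶ A ∧ B) ∷ Γ) Δ
  ∧R   : ∀ {G Γ Δ a A B} → Der Fr G Γ ((a ∶ A) ∷ Δ) → Der Fr G Γ ((a ∶ B) ∷ Δ) →
         Der Fr G Γ ((a ∶ A ∧ B) ∷ Δ)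
  ⇒L   : ∀ {G Γ Δ a A B} → Der Fr G Γ ((a ∶ A) ∷ Δ) → Der Fr G ((a ∶ B) ∷ Γ) Δ →
         Der Fr G ((a ∶ A ⇒ B) ∷ Γ) Δ
  ⇒R   : ∀ {G Γ Δ a A B} → Der Fr G ((a ∶ A) ∷ Γ) ((a ∶ B) ∷ Δ) →
         Der Fr G Γ ((a ∶ A ⇒ B) ∷ Δ)
  ✶L   : ∀ {G Γ Δ x y z A B} → x ≢ y →
         Fresh x G ((z ∶ A ✶ B) ∷ Γ) Δ → Fresh y G ((z ∶ A ✶ B) ∷ Γ) Δ →
         Der Fr (⟨ x , y ▷ z ⟩ ∷ G) ((x ∶ A) ∷ (y ∶ B) ∷ Γ) Δ →
         Der Fr G ((z ∶ A ✶ B) ∷ Γ) Δ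
  -✶R  : ∀ {G Γ Δ x y z A B} → x ≢ y →
         Fresh x G Γ ((z ∶ A -✶ B) ∷ Δ) → Fresh y G Γ ((z ∶ A -✶ B) ∷ Δ) →
         Der Fr (⟨ x , z ▷ y ⟩ ∷ G) ((x ∶ A) ∷ Γ) ((y ∶ B) ∷ Δ) →
         Der Fr G Γ ((z ∶ A -✶ B) ∷ Δ)
  ✶R   : ∀ {G Γ Δ x y z w A B} → ⟨ x , y ▷ z ⟩ ∈ G → E⊢ G z w →
         Der Fr G Γ ((x ∶ A) ∷ (w ∶ A ✶ B) ∷ Δ) →
         Der Fr G Γ ((y ∶ B) ∷ (w ∶ A ✶ B) ∷ Δ) →
         Der Fr G Γ ((w ∶ A ✶ B) ∷ Δ)
  -✶L  : ∀ {G Γ Δ x y z w A B} → ⟨ x , w ▷ y ⟩ ∈ G → E⊢ G z w →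
         Der Fr G ((z ∶ A -✶ B) ∷ Γ) ((x ∶ A) ∷ Δ) →
         Der Fr G ((y ∶ B) ∷ (z ∶ A -✶ B) ∷ Γ) Δ →
         Der Fr G ((z ∶ A -✶ B) ∷ Γ) Δ
  EM   : ∀ {G Γ Δ} (a b : Label) → Der Fr ((a ≐ b) ∷ G) Γ Δ → Der Fr ((a ≭ b) ∷ G) Γ Δ →
         Der Fr G Γ Δ
  axiom : ∀ {G Γ Δ} (ax : FrameAxiom) → ax ∈ Fr →
          let open FrameAxiom ax in
          (θ : Fin m → Label) (b : Fin n → Label) →
          All (λ S → instA θ b S ∈ G) ante →
          All (λ st → E⊢ G (instX θ b (proj₁ st)) (instX θ b (proj₂ st))) eqs →
          (∀ i j → b i ≡ b j → i ≡ j) →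
          (∀ i → Fresh (b i) G Γ Δ) →
          Der Fr (map (instC θ b) cons ++ G) Γ Δ →
          Der Fr G Γ Δ

record Frame : Set₁ where
  field
    H  : Set
    R  : H → H → H → Set
    εH : H

record Model : Set₁ where
  field
    frame : Frame
  open Frame frame public
  field
    v : Var → H → Set

module _ (Fm : Frame) where
  open Frame Fm

  module _ {m : ℕ} (ρ : Fin m → H) where
    ⟦_⟧x : XT m → H
    ⟦ x i ⟧x = ρ i
    ⟦ eps ⟧x = εH

    holdsA : Ante m → Set
    holdsA (tri u v w) = R (ρ u) (ρ v) (ρ w)
    holdsA (neq s t)   = ⟦ s ⟧x ≢ ⟦ t ⟧x

  module _ {m n : ℕ} (ρ : Fin m → H) (τ : Fin n → H) where
    ⟦_⟧y : YT m n → H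
    ⟦ x i ⟧y = ρ i
    ⟦ y j ⟧y = τ j
    ⟦ eps ⟧y = εH

    holdsC : Cons m n → Set
    holdsC (tri a b c) = R ⟦ a ⟧y ⟦ b ⟧y ⟦ c ⟧y
    holdsC (eq a b)    = ⟦ a ⟧y ≡ ⟦ b ⟧y
    holdsC (neq a b)   = ⟦ a ⟧y ≢ ⟦ b ⟧y

  Satisfies : FrameAxiom → Set
  Satisfies ax =
    let open FrameAxiom ax in
    (ρ : Fin m → H) →
    All (λ st → ⟦_⟧x ρ (proj₁ st) ≡ ⟦_⟧x ρ (proj₂ st)) eqs →
    All (holdsA ρ) ante →
    Σ (Fin n → H) (λ τ → All (holdsC ρ τ) cons)

module _ (M : Model) where
  open Model M

  infix 4 _⊩_
  _⊩_ : H → Formula → Set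
  h ⊩ var p    = v p h
  h ⊩ ⊤ᶠ       = ⊤
  h ⊩ ⊥ᶠ       = ⊥
  h ⊩ ⊤*       = h ≡ εH
  h ⊩ A ∧ B    = h ⊩ A × h ⊩ B
  h ⊩ A ⇒ B    = h ⊩ A → h ⊩ B
  h ⊩ A ✶ B    = Σ H (λ h₁ → Σ H (λ h₂ → R h₁ h₂ h × h₁ ⊩ A × h₂ ⊩ B))
  h ⊩ A -✶ B   = ∀ h₁ h₂ → R h₁ h h₂ → h₁ ⊩ A → h₂ ⊩ B

Valid : List FrameAxiom → Formula → Set₁
Valid Fr F = (M : Model) → All (Satisfies (Model.frame M)) Fr →
             (h : Model.H M) → _⊩_ M h F

module Submission where

-- Starting from the underivable sequent ∅ ; ∅ ⊢ w : F we build an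
-- increasing chain of underivable sequents.  Step n applies one task
-- backwards: a logical rule to a formula of Γ or Δ, EM to a pair of
-- labels, or the rule synthesised from an axiom of Fr to an instance; for
-- a two-premise rule excluded middle selects an underivable premise.  A
-- fair schedule (Cantor pairing) performs every task arbitrarily late, so
-- the limit of the chain is saturated under all rules.  The counter-model
-- has as worlds the labels modulo the equalities of the limit, and reads
-- R and the valuation off the limit.  Truth lemma: formulae on the left of
-- the limit are forced, those on the right are not.  Saturation under the
-- synthesised rules makes the frame satisfy Fr, linearity of antecedents
-- allowing their ternary atoms to be realised independently.

open import Defs renaming (x to xᵗ; y to yᵗ)
open import Level using (0ℓ)
open import Axiom.ExcludedMiddle using (ExcludedMiddle)
open import Data.Nat using (ℕ; zero; suc; _+_; _∸_; _≤_; _<_; _≤′_; ≤′-refl; ≤′-step; z≤n; s≤s; _⊔_)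
open import Data.Nat.Properties
  using (+-suc; +-identityʳ; m≤n+m; m≤m+n; m+n∸n≡m; ≤-refl; ≤-trans; ≤-antisym; ≤-total; n≤1+n;
         m≤m⊔n; m≤n⊔m; ≤⇒≤′; ≤-pred; m≤n⇒m<n∨m≡n; n≮n; n∸n≡0; +-cancelˡ-≡; suc-injective; ≡-irrelevant)
open import Data.Fin using (Fin; toℕ) renaming (zero to fzero; suc to fsuc)
open import Data.Fin.Properties using (toℕ-injective; _≟_)
open import Data.List using (List; []; _∷_; _++_; map; concatMap)
open import Data.List.Properties using (++-assoc; ++-identityʳ)
open import Data.List.Membership.Propositional using (_∈_)
open import Data.List.Membership.Propositional.Properties using (∈-++⁺ˡ; ∈-++⁺ʳ; ∈-map⁺)
open import Data.List.Relation.Binary.Subset.Propositional using (_⊆_)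
open import Data.List.Relation.Binary.Subset.Propositional.Properties using (⊆-refl; Any-resp-⊆)
open import Data.List.Relation.Binary.Permutation.Propositional using (_↭_; ↭-sym; ↭-reflexive)
open import Data.List.Relation.Binary.Permutation.Propositional.Properties using (∈-resp-↭; ++-comm)
open import Data.List.Relation.Unary.Any using (Any; here; there)
open import Data.List.Relation.Unary.All as All using (All; []; _∷_)
open import Data.List.Relation.Unary.Unique.Propositional using (Unique)
open import Data.List.Relation.Unary.AllPairs using (_∷_)
open import Data.Maybe using (Maybe; just; nothing)
open import Data.Product using (Σ; _×_; _,_; proj₁; proj₂)
open import Data.Sum using (_⊎_; inj₁; inj₂)
open import Data.Empty using (⊥; ⊥-elim)
open import Function using (_∘_)
open import Data.Unit using (⊤; tt)
open import Relation.Nullary using (¬_; Dec; yes; no)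
open import Relation.Binary.PropositionalEquality
  using (_≡_; _≢_; refl; cong; cong₂; subst; subst₂)
  renaming (sym to ≡-sym; trans to ≡-trans)

≋-refl : {A : Set} {xs : List A} → xs ≋ xs
≋-refl _ = (λ p → p) , (λ p → p)

≋-sym : {A : Set} {xs ys : List A} → xs ≋ ys → ys ≋ xs
≋-sym e z = proj₂ (e z) , proj₁ (e z)

↭⇒≋ : {A : Set} {xs ys : List A} → xs ↭ ys → xs ≋ ys
↭⇒≋ p _ = ∈-resp-↭ p , ∈-resp-↭ (↭-sym p)

absorb-⊆ : {A : Set} {x : A} {xs : List A} → x ∈ xs → (x ∷ xs) ⊆ xs
absorb-⊆ m (here refl) = m
absorb-⊆ m (there p) = p

absorb : {A : Set} {x : A} {xs : List A} → x ∈ xs → (x ∷ xs) ≋ xs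
absorb m _ = absorb-⊆ m , there

absorb-under : {A : Set} {x y : A} {xs : List A} → x ∈ xs → (y ∷ x ∷ xs) ≋ (y ∷ xs)
absorb-under m z with absorb m z
... | f , g = (λ { (here p) → here p ; (there p) → there (f p) }) ,
              (λ { (here p) → here p ; (there p) → there (g p) })

entry : {A : Set} (xs : List A) → ℕ → Maybe (Σ A (_∈ xs))
entry [] _ = nothing
entry (x ∷ xs) zero = just (x , here refl)
entry (x ∷ xs) (suc i) with entry xs i
... | nothing = nothing
... | just (y , p) = just (y , there p)

At : {A : Set} → List A → ℕ → A → Set
At xs i x = Σ (x ∈ xs) λ p → entry xs i ≡ just (x , p)

∈⇒At : {A : Set} {x : A} {xs : List A} → x ∈ xs → Σ ℕ λ i → At xs i x
∈⇒At (here refl) = zero , here refl , refl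
∈⇒At {xs = y ∷ ys} (there m) with ∈⇒At m
... | i , p , e = suc i , there p , cong-there e
  where
  cong-there : entry ys i ≡ just (_ , p) → entry (y ∷ ys) (suc i) ≡ just (_ , there p)
  cong-there e rewrite e = refl

At-++ : {A : Set} {x : A} {xs : List A} (ys : List A) {i : ℕ} → At xs i x → At (xs ++ ys) i x
At-++ {xs = []} ys (_ , ())
At-++ {xs = x ∷ xs} ys {zero} (_ , refl) = here refl , refl
At-++ {xs = y ∷ xs} ys {suc i} (p , e) with entry xs i in e′
At-++ {xs = y ∷ xs} ys {suc i} (p , refl) | just (z , q) with At-++ ys {i} (q , e′)
... | r , e″ rewrite e″ = there r , refl

-- Cantor's enumeration of ℕ × ℕ along the anti-diagonals.
nextPair : ℕ × ℕ → ℕ × ℕ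
nextPair (zero , b) = suc b , zero
nextPair (suc a , b) = a , suc b

unpair : ℕ → ℕ × ℕ
unpair zero = 0 , 0
unpair (suc n) = nextPair (unpair n)

-- triangle d = 0 + 1 + … + d is the position of (d , 0).
triangle : ℕ → ℕ
triangle zero = zero
triangle (suc d) = triangle d + suc d

pair : ℕ → ℕ → ℕ
pair a b = triangle (a + b) + b

private
  ∸-suc : ∀ d b → suc b ≤ d → d ∸ b ≡ suc (d ∸ suc b)
  ∸-suc (suc d) zero _ = refl
  ∸-suc (suc d) (suc b) (s≤s le) = ∸-suc d b le

  mutual
    unpair-diagonal-start : ∀ d → unpair (triangle d) ≡ (d , 0)
    unpair-diagonal-start zero = refl
    unpair-diagonal-start (suc d)
      rewrite +-suc (triangle d) d | unpair-diagonal d d ≤-refl | n∸n≡0 d = refl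

    unpair-diagonal : ∀ d b → b ≤ d → unpair (triangle d + b) ≡ (d ∸ b , b)
    unpair-diagonal d zero _ rewrite +-identityʳ (triangle d) = unpair-diagonal-start d
    unpair-diagonal d (suc b) le
      rewrite +-suc (triangle d) b | unpair-diagonal d b (≤-trans (n≤1+n b) le) | ∸-suc d b le = refl

unpair-pair : ∀ a b → unpair (pair a b) ≡ (a , b)
unpair-pair a b rewrite unpair-diagonal (a + b) b (m≤n+m b a) | m+n∸n≡m a b = refl

pair-≥ : ∀ a b → b ≤ pair a b
pair-≥ a b = m≤n+m b (triangle (a + b))

-- Coding of finite tuples of numbers (substitution instances of axioms).
encodeTuple : (m : ℕ) → (Fin m → ℕ) → ℕ
encodeTuple zero _ = 0
encodeTuple (suc m) θ = pair (θ fzero) (encodeTuple m (λ i → θ (fsuc i)))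

decodeTuple : (m : ℕ) → ℕ → Fin m → ℕ
decodeTuple (suc m) c fzero = proj₁ (unpair c)
decodeTuple (suc m) c (fsuc i) = decodeTuple m (proj₂ (unpair c)) i

decode-encode : ∀ m θ i → decodeTuple m (encodeTuple m θ) i ≡ θ i
decode-encode (suc m) θ fzero
  rewrite unpair-pair (θ fzero) (encodeTuple m (λ i → θ (fsuc i))) = refl
decode-encode (suc m) θ (fsuc i)
  rewrite unpair-pair (θ fzero) (encodeTuple m (λ i → θ (fsuc i))) = decode-encode m (λ i → θ (fsuc i)) i

module _ {P : ℕ → Set} (P? : ∀ b → Dec (P b)) where
  leastUpTo : ℕ → ℕ
  leastUpTo zero = zero
  leastUpTo (suc n) with P? (leastUpTo n)
  ... | yes _ = leastUpTo n
  ... | no _ = suc n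

  leastUpTo-≤ : ∀ n → leastUpTo n ≤ n
  leastUpTo-≤ zero = z≤n
  leastUpTo-≤ (suc n) with P? (leastUpTo n)
  ... | yes _ = ≤-trans (leastUpTo-≤ n) (n≤1+n n)
  ... | no _ = ≤-refl

  leastUpTo-least : ∀ n b → b ≤ n → P b → P (leastUpTo n) × leastUpTo n ≤ b
  leastUpTo-least zero zero z≤n pb = pb , z≤n
  leastUpTo-least (suc n) b le pb with P? (leastUpTo n) | m≤n⇒m<n∨m≡n le
  ... | yes p | inj₁ b<1+n = p , proj₂ (leastUpTo-least n b (≤-pred b<1+n) pb)
  ... | yes p | inj₂ refl = p , ≤-trans (leastUpTo-≤ n) (n≤1+n n)
  ... | no ¬p | inj₁ b<1+n = ⊥-elim (¬p (proj₁ (leastUpTo-least n b (≤-pred b<1+n) pb)))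
  ... | no ¬p | inj₂ refl = pb , ≤-refl

E⊢-mono : ∀ {G G′} → G ⊆ G′ → ∀ {a b} → E⊢ G a b → E⊢ G′ a b
E⊢-mono s (base p) = base (s p)
E⊢-mono s refl = refl
E⊢-mono s (sym e) = sym (E⊢-mono s e)
E⊢-mono s (trans e e′) = trans (E⊢-mono s e) (E⊢-mono s e′)

-- An upper bound for the labels of a sequent; any label beyond it is
-- fresh, which is how the rules ✶L, -✶R and the axiom rules obtain
-- their new labels.
boundAtom : RelAtom → ℕ
boundAtom ⟨ a , b ▷ c ⟩ = a ⊔ (b ⊔ c)
boundAtom (a ≐ b) = a ⊔ b
boundAtom (a ≭ b) = a ⊔ b

boundG : List RelAtom → ℕ
boundG [] = 0
boundG (r ∷ G) = boundAtom r ⊔ boundG G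

boundL : List LFormula → ℕ
boundL [] = 0
boundL (φ ∷ Γ) = lab φ ⊔ boundL Γ

bound : List RelAtom → List LFormula → List LFormula → ℕ
bound G Γ Δ = boundG G ⊔ (boundL Γ ⊔ boundL Δ)

private
  occursAtom≤ : ∀ l r → OccRA l r → l ≤ boundAtom r
  occursAtom≤ l ⟨ a , b ▷ c ⟩ (inj₁ refl) = m≤m⊔n a (b ⊔ c)
  occursAtom≤ l ⟨ a , b ▷ c ⟩ (inj₂ (inj₁ refl)) = ≤-trans (m≤m⊔n b c) (m≤n⊔m a (b ⊔ c))
  occursAtom≤ l ⟨ a , b ▷ c ⟩ (inj₂ (inj₂ refl)) = ≤-trans (m≤n⊔m b c) (m≤n⊔m a (b ⊔ c))
  occursAtom≤ l (a ≐ b) (inj₁ refl) = m≤m⊔n a b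
  occursAtom≤ l (a ≐ b) (inj₂ refl) = m≤n⊔m a b
  occursAtom≤ l (a ≭ b) (inj₁ refl) = m≤m⊔n a b
  occursAtom≤ l (a ≭ b) (inj₂ refl) = m≤n⊔m a b

  occursG≤ : ∀ l G → Any (OccRA l) G → l ≤ boundG G
  occursG≤ l (r ∷ G) (here p) = ≤-trans (occursAtom≤ l r p) (m≤m⊔n _ _)
  occursG≤ l (r ∷ G) (there p) = ≤-trans (occursG≤ l G p) (m≤n⊔m _ _)

  occursL≤ : ∀ l Γ → Any (λ φ → l ≡ lab φ) Γ → l ≤ boundL Γ
  occursL≤ l (φ ∷ Γ) (here refl) = m≤m⊔n _ _
  occursL≤ l (φ ∷ Γ) (there p) = ≤-trans (occursL≤ l Γ p) (m≤n⊔m _ _)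

occurs≤bound : ∀ l G Γ Δ → Occurs l G Γ Δ → l ≤ bound G Γ Δ
occurs≤bound l G Γ Δ (inj₁ p) = ≤-trans (occursG≤ l G p) (m≤m⊔n _ _)
occurs≤bound l G Γ Δ (inj₂ (inj₁ p)) =
  ≤-trans (≤-trans (occursL≤ l Γ p) (m≤m⊔n _ _)) (m≤n⊔m (boundG G) _)
occurs≤bound l G Γ Δ (inj₂ (inj₂ p)) =
  ≤-trans (≤-trans (occursL≤ l Δ p) (m≤n⊔m _ _)) (m≤n⊔m (boundG G) _)

fresh-beyond : ∀ {G Γ Δ G′ Γ′ Δ′} l → G′ ⊆ G → Γ′ ⊆ Γ → Δ′ ⊆ Δ →
               bound G Γ Δ < l → Fresh l G′ Γ′ Δ′
fresh-beyond {G} {Γ} {Δ} (suc l) sG sΓ sΔ lt = (λ ()) , λ o → n≮n (suc l) (≤-trans (s≤s (occurs≤bound _ G Γ Δ (shrink o))) lt)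
  where
  shrink : Occurs (suc l) _ _ _ → Occurs (suc l) G Γ Δ
  shrink (inj₁ p) = inj₁ (Any-resp-⊆ sG p)
  shrink (inj₂ (inj₁ p)) = inj₂ (inj₁ (Any-resp-⊆ sΓ p))
  shrink (inj₂ (inj₂ p)) = inj₂ (inj₂ (Any-resp-⊆ sΔ p))

Monotone : (ℕ → Set) → Set
Monotone P = ∀ {k n} → k ≤ n → P k → P n

Eventually : (ℕ → Set) → Set
Eventually P = Σ ℕ P

monotone-× : ∀ {P Q} → Monotone P → Monotone Q → Monotone (λ n → P n × Q n)
monotone-× mP mQ le (p , q) = mP le p , mQ le q

eventually-both : ∀ {P Q} → Monotone P → Monotone Q →
                  Eventually P → Eventually Q → Eventually (λ n → P n × Q n)
eventually-both mP mQ (k , p) (n , q) = k ⊔ n , mP (m≤m⊔n k n) p , mQ (m≤n⊔m k n) q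

eventually-all : {X : Set} {P : X → ℕ → Set} → (∀ {x} → Monotone (P x)) → {xs : List X} →
                 All (λ x → Eventually (P x)) xs → Eventually (λ n → All (λ x → P x n) xs)
eventually-all mP [] = 0 , []
eventually-all mP (p ∷ ps) with eventually-both mP (λ le → All.map (mP le)) p (eventually-all mP ps)
... | n , q , qs = n , q ∷ qs

update : {m : ℕ} {A : Set} → (Fin m → A) → Fin m → A → Fin m → A
update θ u a i with i ≟ u
... | yes _ = a
... | no _ = θ i

update-hit : ∀ {m A} (θ : Fin m → A) u a → update θ u a u ≡ a
update-hit θ u a with u ≟ u
... | yes _ = refl
... | no u≢u = ⊥-elim (u≢u refl)

update-miss : ∀ {m A} (θ : Fin m → A) {u i} a → i ≢ u → update θ u a i ≡ θ i
update-miss θ {u} {i} a i≢u with i ≟ u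
... | yes i≡u = ⊥-elim (i≢u i≡u)
... | no _ = refl

update-preserves : ∀ {m A} (P : Fin m → A → Set) (θ : Fin m → A) {u a} →
                   (∀ i → P i (θ i)) → P u a → ∀ i → P i (update θ u a i)
update-preserves P θ {u} hθ ha i with i ≟ u
... | yes refl = ha
... | no _ = hθ i

unique-drop : {A : Set} (xs : List A) {ys : List A} → Unique (xs ++ ys) → Unique ys
unique-drop [] u = u
unique-drop (x ∷ xs) (_ ∷ u) = unique-drop xs u

-- The principal formula of a rule stays in the sequent: a rule concluding
-- φ ∷ Γ may be applied to any Γ containing φ, and conversely premises
-- may repeat a formula already present.
module _ {Fr : List FrameAxiom} {G : List RelAtom} {Γ Δ : List LFormula} {φ : LFormula} where
  contractL : φ ∈ Γ → Der Fr G (φ ∷ Γ) Δ → Der Fr G Γ Δ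
  contractL p = set-eq ≋-refl (absorb p) ≋-refl

  contractR : φ ∈ Δ → Der Fr G Γ (φ ∷ Δ) → Der Fr G Γ Δ
  contractR p = set-eq ≋-refl ≋-refl (absorb p)

  weakenL : φ ∈ Γ → Der Fr G Γ Δ → Der Fr G (φ ∷ Γ) Δ
  weakenL p = set-eq ≋-refl (≋-sym (absorb p)) ≋-refl

  weakenL-under : ∀ {ψ} → φ ∈ Γ → Der Fr G (ψ ∷ Γ) Δ → Der Fr G (ψ ∷ φ ∷ Γ) Δ
  weakenL-under p = set-eq ≋-refl (≋-sym (absorb-under p)) ≋-refl

  weakenR-under : ∀ {ψ} → φ ∈ Δ → Der Fr G Γ (ψ ∷ Δ) → Der Fr G Γ (ψ ∷ φ ∷ Δ)
  weakenR-under p = set-eq ≋-refl ≋-refl (≋-sym (absorb-under p))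

▷-cong : ∀ {a b c a′ b′ c′} → a ≡ a′ → b ≡ b′ → c ≡ c′ → ⟨ a , b ▷ c ⟩ ≡ ⟨ a′ , b′ ▷ c′ ⟩
▷-cong refl refl refl = refl

module _ {m n : ℕ} {θ θ′ : Fin m → Label} (θ≗θ′ : ∀ i → θ i ≡ θ′ i) where
  instX-ext : ∀ {σ σ′ : Fin n → Label} s → instX θ σ s ≡ instX θ′ σ′ s
  instX-ext (xᵗ i) = θ≗θ′ i
  instX-ext eps = refl

  instA-ext : ∀ {σ σ′ : Fin n → Label} S → instA θ σ S ≡ instA θ′ σ′ S
  instA-ext (tri u v w) = ▷-cong (θ≗θ′ u) (θ≗θ′ v) (θ≗θ′ w)
  instA-ext {σ} {σ′} (neq s t) = cong₂ _≭_ (instX-ext {σ} {σ′} s) (instX-ext {σ} {σ′} t)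

  instY-ext : ∀ {σ : Fin n → Label} e → instY θ σ e ≡ instY θ′ σ e
  instY-ext (xᵗ i) = θ≗θ′ i
  instY-ext (yᵗ j) = refl
  instY-ext eps = refl

  instC-ext : ∀ {σ : Fin n → Label} C → instC θ σ C ≡ instC θ′ σ C
  instC-ext {σ} (tri a b c) = ▷-cong (instY-ext {σ} a) (instY-ext {σ} b) (instY-ext {σ} c)
  instC-ext {σ} (eq a b) = cong₂ _≐_ (instY-ext {σ} a) (instY-ext {σ} b)
  instC-ext {σ} (neq a b) = cong₂ _≭_ (instY-ext {σ} a) (instY-ext {σ} b)

ApplicableWith : List RelAtom → (ax : FrameAxiom) →
                 (Fin (FrameAxiom.m ax) → Label) → (Fin (FrameAxiom.n ax) → Label) → Set
ApplicableWith G ax θ σ =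
  All (λ S → instA θ σ S ∈ G) ante ×
  All (λ st → E⊢ G (instX θ σ (proj₁ st)) (instX θ σ (proj₂ st))) eqs
  where open FrameAxiom ax

applicable-ext : ∀ {G} ax {θ θ′ σ σ′} → (∀ i → θ i ≡ θ′ i) →
                 ApplicableWith G ax θ σ → ApplicableWith G ax θ′ σ′
applicable-ext {G} ax {σ = σ} {σ′} θ≗θ′ (antecedents , equations) =
  All.map (λ {S} → subst (_∈ G) (instA-ext θ≗θ′ {σ} {σ′} S)) antecedents ,
  All.map (λ {st} → subst₂ (E⊢ G) (instX-ext θ≗θ′ {σ} {σ′} (proj₁ st)) (instX-ext θ≗θ′ {σ} {σ′} (proj₂ st)))
          equations

Applicable : List RelAtom → (ax : FrameAxiom) → (Fin (FrameAxiom.m ax) → Label) → Set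
Applicable G ax θ = ApplicableWith G ax θ (λ _ → ε)

Applicable-mono : ∀ {G G′} ax {θ} → G ⊆ G′ → Applicable G ax θ → Applicable G′ ax θ
Applicable-mono ax s (antecedents , equations) = All.map s antecedents , All.map (E⊢-mono s) equations

-- Tasks of the saturation process: apply a rule to the i-th formula of Γ
-- or Δ (j selects the relational atom used by -✶L and ✶R), split on
-- a = b by EM, or apply the rule of the k-th axiom to the instance coded c.
data Task : Set where
  onLeft onRight splitEq useAxiom : ℕ → ℕ → Task

encodeTask : Task → ℕ
encodeTask (onLeft i j) = pair 0 (pair i j)
encodeTask (onRight i j) = pair 1 (pair i j)
encodeTask (splitEq a b) = pair 2 (pair a b)
encodeTask (useAxiom k c) = pair 3 (pair k c)

taskOfKind : ℕ → ℕ → ℕ → Task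
taskOfKind 0 = onLeft
taskOfKind 1 = onRight
taskOfKind 2 = splitEq
taskOfKind _ = useAxiom

decodeTask : ℕ → Task
decodeTask t = taskOfKind (proj₁ (unpair t)) (proj₁ (unpair (proj₂ (unpair t)))) (proj₂ (unpair (proj₂ (unpair t))))

decode-encodeTask : ∀ t → decodeTask (encodeTask t) ≡ t
decode-encodeTask (onLeft i j) rewrite unpair-pair 0 (pair i j) | unpair-pair i j = refl
decode-encodeTask (onRight i j) rewrite unpair-pair 1 (pair i j) | unpair-pair i j = refl
decode-encodeTask (splitEq i j) rewrite unpair-pair 2 (pair i j) | unpair-pair i j = refl
decode-encodeTask (useAxiom i j) rewrite unpair-pair 3 (pair i j) | unpair-pair i j = refl

schedule : ℕ → Task
schedule n = decodeTask (proj₁ (unpair n))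

schedule-fair : ∀ t k₀ → Σ ℕ λ n → k₀ ≤ n × schedule n ≡ t
schedule-fair t k₀ = pair (encodeTask t) k₀ , pair-≥ (encodeTask t) k₀ , scheduled
  where
  scheduled : schedule (pair (encodeTask t) k₀) ≡ t
  scheduled rewrite unpair-pair (encodeTask t) k₀ = decode-encodeTask t

record Seq : Set where
  constructor sq
  field
    G : List RelAtom
    Γ : List LFormula
    Δ : List LFormula
open Seq

record Addition : Set where
  constructor add
  field
    newG : List RelAtom
    newΓ : List LFormula
    newΔ : List LFormula
open Addition

_⊕_ : Seq → Addition → Seq
S ⊕ a = sq (G S ++ newG a) (Γ S ++ newΓ a) (Δ S ++ newΔ a)

_⊞_ : Addition → Addition → Addition
a ⊞ b = add (newG a ++ newG b) (newΓ a ++ newΓ b) (newΔ a ++ newΔ b)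

nothingNew : Addition
nothingNew = add [] [] []

sq-≡ : ∀ {G G′ Γ Γ′ Δ Δ′} → G ≡ G′ → Γ ≡ Γ′ → Δ ≡ Δ′ → sq G Γ Δ ≡ sq G′ Γ′ Δ′
sq-≡ refl refl refl = refl

_≼_ : Seq → Seq → Set
S ≼ T = Σ Addition λ a → T ≡ S ⊕ a

≼-refl : ∀ {S} → S ≼ S
≼-refl = nothingNew , ≡-sym (sq-≡ (++-identityʳ _) (++-identityʳ _) (++-identityʳ _))

≼-trans : ∀ {S T U} → S ≼ T → T ≼ U → S ≼ U
≼-trans {S} (a , refl) (b , refl) =
  a ⊞ b , sq-≡ (++-assoc (G S) _ _) (++-assoc (Γ S) _ _) (++-assoc (Δ S) _ _)

≼-G : ∀ {S T} → S ≼ T → G S ⊆ G T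
≼-G (a , refl) = ∈-++⁺ˡ

≼-Γ : ∀ {S T} → S ≼ T → Γ S ⊆ Γ T
≼-Γ (a , refl) = ∈-++⁺ˡ

≼-Δ : ∀ {S T} → S ≼ T → Δ S ⊆ Δ T
≼-Δ (a , refl) = ∈-++⁺ˡ

≼-AtG : ∀ {S T i r} → S ≼ T → At (G S) i r → At (G T) i r
≼-AtG (a , refl) = At-++ (newG a)

≼-AtΓ : ∀ {S T i φ} → S ≼ T → At (Γ S) i φ → At (Γ T) i φ
≼-AtΓ (a , refl) = At-++ (newΓ a)

≼-AtΔ : ∀ {S T i φ} → S ≼ T → At (Δ S) i φ → At (Δ T) i φ
≼-AtΔ (a , refl) = At-++ (newΔ a)

freshLabel : Seq → ℕ → Label
freshLabel S k = suc (bound (G S) (Γ S) (Δ S) + k)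

freshLabel-fresh : ∀ S k {G′ Γ′ Δ′} → G′ ⊆ G S → Γ′ ⊆ Γ S → Δ′ ⊆ Δ S → Fresh (freshLabel S k) G′ Γ′ Δ′
freshLabel-fresh S k sG sΓ sΔ = fresh-beyond _ sG sΓ sΔ (s≤s (m≤m+n _ k))

freshLabel-injective : ∀ S {k l} → freshLabel S k ≡ freshLabel S l → k ≡ l
freshLabel-injective S e = +-cancelˡ-≡ (bound (G S) (Γ S) (Δ S)) _ _ (suc-injective e)

freshLabel-0≢1 : ∀ S → freshLabel S 0 ≢ freshLabel S 1
freshLabel-0≢1 S e with freshLabel-injective S {0} {1} e
... | ()

-- The saturation process, classical: excluded middle decides
-- derivability of premises and applicability of rules.
module Construction (em : ExcludedMiddle 0ℓ) (Fr : List FrameAxiom) where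

  Derivable : Seq → Set
  Derivable S = Der Fr (G S) (Γ S) (Δ S)

  Premise : Seq → Addition → Set
  Premise S a = Der Fr (newG a ++ G S) (newΓ a ++ Γ S) (newΔ a ++ Δ S)

  toPremise : ∀ {S} a → Derivable (S ⊕ a) → Premise S a
  toPremise {S} a = set-eq (↭⇒≋ (++-comm (G S) _)) (↭⇒≋ (++-comm (Γ S) _)) (↭⇒≋ (++-comm (Δ S) _))

  -- A refinement of S adds material whose derivability implies that of S;
  -- it is a backward rule application keeping one underivable premise.
  record Refinement (S : Seq) : Set where
    constructor refine
    field
      added   : Addition
      reflect : Derivable (S ⊕ added) → Derivable S
  open Refinement

  unchanged : (S : Seq) → Refinement S
  unchanged S = refine nothingNew (set-eq (↭⇒≋ (↭-reflexive (++-identityʳ _)))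
                                          (↭⇒≋ (↭-reflexive (++-identityʳ _)))
                                          (↭⇒≋ (↭-reflexive (++-identityʳ _))))

  oneRule : (S : Seq) (a : Addition) → (Premise S a → Derivable S) → Refinement S
  oneRule S a rule = refine a (rule ∘ toPremise a)

  twoRule : (S : Seq) (a₁ a₂ : Addition) → (Premise S a₁ → Premise S a₂ → Derivable S) → Refinement S
  twoRule S a₁ a₂ rule with em {Derivable (S ⊕ a₁)}
  ... | yes d₁ = refine a₂ (rule (toPremise a₁ d₁) ∘ toPremise a₂)
  ... | no ¬d₁ = refine a₁ (⊥-elim ∘ ¬d₁)

  twoRule-added : ∀ S a₁ a₂ rule → added (twoRule S a₁ a₂ rule) ≡ a₁ ⊎ added (twoRule S a₁ a₂ rule) ≡ a₂
  twoRule-added S a₁ a₂ rule with em {Derivable (S ⊕ a₁)}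
  ... | yes _ = inj₂ refl
  ... | no _ = inj₁ refl

  wandLeft : (S : Seq) {z : Label} {A B : Formula} → (z ∶ A -✶ B) ∈ Γ S →
             Maybe (Σ RelAtom (_∈ G S)) → Refinement S
  wandLeft S {z} {A} {B} p (just (⟨ u , w ▷ v ⟩ , r)) with em {E⊢ (G S) z w}
  ... | yes z=w = twoRule S (add [] [] ((u ∶ A) ∷ [])) (add [] ((v ∶ B) ∷ []) [])
                    (λ d₁ d₂ → contractL p (-✶L r z=w (weakenL p d₁) (weakenL-under p d₂)))
  ... | no _ = unchanged S
  wandLeft S _ _ = unchanged S

  starRight : (S : Seq) {w : Label} {A B : Formula} → (w ∶ A ✶ B) ∈ Δ S →
              Maybe (Σ RelAtom (_∈ G S)) → Refinement S
  starRight S {w} {A} {B} p (just (⟨ u , v ▷ z ⟩ , r)) with em {E⊢ (G S) z w}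
  ... | yes z=w = twoRule S (add [] [] ((u ∶ A) ∷ [])) (add [] [] ((v ∶ B) ∷ []))
                    (λ d₁ d₂ → contractR p (✶R r z=w (weakenR-under p d₁) (weakenR-under p d₂)))
  ... | no _ = unchanged S
  starRight S _ _ = unchanged S

  leftRule : (S : Seq) (φ : LFormula) → φ ∈ Γ S → ℕ → Refinement S
  leftRule S (a ∶ var _) _ _ = unchanged S
  leftRule S (a ∶ ⊤ᶠ) _ _ = unchanged S
  leftRule S (a ∶ ⊥ᶠ) _ _ = unchanged S
  leftRule S (a ∶ ⊤*) p _ = oneRule S (add ((a ≐ ε) ∷ []) [] []) (contractL p ∘ ⊤*L)
  leftRule S (a ∶ A ∧ B) p _ = oneRule S (add [] ((a ∶ A) ∷ (a ∶ B) ∷ []) []) (contractL p ∘ ∧L)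
  leftRule S (a ∶ A ⇒ B) p _ =
    twoRule S (add [] [] ((a ∶ A) ∷ [])) (add [] ((a ∶ B) ∷ []) []) (λ d₁ d₂ → contractL p (⇒L d₁ d₂))
  leftRule S (z ∶ A ✶ B) p _ =
    oneRule S (add (⟨ x , y ▷ z ⟩ ∷ []) ((x ∶ A) ∷ (y ∶ B) ∷ []) [])
      (contractL p ∘ ✶L (freshLabel-0≢1 S) (freshLabel-fresh S 0 ⊆-refl (absorb-⊆ p) ⊆-refl)
                               (freshLabel-fresh S 1 ⊆-refl (absorb-⊆ p) ⊆-refl))
    where
    x y : Label
    x = freshLabel S 0
    y = freshLabel S 1
  leftRule S (z ∶ A -✶ B) p j = wandLeft S p (entry (G S) j)

  rightRule : (S : Seq) (φ : LFormula) → φ ∈ Δ S → ℕ → Refinement S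
  rightRule S (a ∶ var _) _ _ = unchanged S
  rightRule S (a ∶ ⊤ᶠ) _ _ = unchanged S
  rightRule S (a ∶ ⊥ᶠ) _ _ = unchanged S
  rightRule S (a ∶ ⊤*) _ _ = unchanged S
  rightRule S (a ∶ A ∧ B) p _ =
    twoRule S (add [] [] ((a ∶ A) ∷ [])) (add [] [] ((a ∶ B) ∷ [])) (λ d₁ d₂ → contractR p (∧R d₁ d₂))
  rightRule S (a ∶ A ⇒ B) p _ = oneRule S (add [] ((a ∶ A) ∷ []) ((a ∶ B) ∷ [])) (contractR p ∘ ⇒R)
  rightRule S (w ∶ A ✶ B) p j = starRight S p (entry (G S) j)
  rightRule S (z ∶ A -✶ B) p _ =
    oneRule S (add (⟨ x , z ▷ y ⟩ ∷ []) ((x ∶ A) ∷ []) ((y ∶ B) ∷ []))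
      (contractR p ∘ -✶R (freshLabel-0≢1 S) (freshLabel-fresh S 0 ⊆-refl ⊆-refl (absorb-⊆ p))
                                (freshLabel-fresh S 1 ⊆-refl ⊆-refl (absorb-⊆ p)))
    where
    x y : Label
    x = freshLabel S 0
    y = freshLabel S 1

  axiomRule : (S : Seq) (ax : FrameAxiom) → ax ∈ Fr → (Fin (FrameAxiom.m ax) → Label) → Refinement S
  axiomRule S ax ax∈Fr θ with em {Applicable (G S) ax θ}
  ... | yes applicable =
        oneRule S (add (map (instC θ new) cons) [] [])
          (axiom ax ax∈Fr θ new (proj₁ applicableNew) (proj₂ applicableNew)
                 (λ i j → toℕ-injective ∘ freshLabel-injective S)
                 (λ i → freshLabel-fresh S (toℕ i) ⊆-refl ⊆-refl ⊆-refl))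
    where
    open FrameAxiom ax
    new : Fin n → Label
    new i = freshLabel S (toℕ i)
    applicableNew : ApplicableWith (G S) ax θ new
    applicableNew = applicable-ext ax {θ} {θ} {λ _ → ε} {new} (λ _ → refl) applicable
  ... | no _ = unchanged S

  perform : Task → (S : Seq) → Refinement S
  perform (onLeft i j) S with entry (Γ S) i
  ... | just (φ , p) = leftRule S φ p j
  ... | nothing = unchanged S
  perform (onRight i j) S with entry (Δ S) i
  ... | just (φ , p) = rightRule S φ p j
  ... | nothing = unchanged S
  perform (splitEq a b) S =
    twoRule S (add ((a ≐ b) ∷ []) [] []) (add ((a ≭ b) ∷ []) [] []) (EM a b)
  perform (useAxiom k c) S with entry Fr k
  ... | just (ax , ax∈Fr) = axiomRule S ax ax∈Fr (decodeTuple (FrameAxiom.m ax) c)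
  ... | nothing = unchanged S

  wandLeft-added : ∀ S {z A B u w v} (p : (z ∶ A -✶ B) ∈ Γ S) (r : ⟨ u , w ▷ v ⟩ ∈ G S) → E⊢ (G S) z w →
                   added (wandLeft S p (just (_ , r))) ≡ add [] [] ((u ∶ A) ∷ [])
                 ⊎ added (wandLeft S p (just (_ , r))) ≡ add [] ((v ∶ B) ∷ []) []
  wandLeft-added S {z} {w = w} p r z=w with em {E⊢ (G S) z w}
  ... | yes _ = twoRule-added S _ _ _
  ... | no z≠w = ⊥-elim (z≠w z=w)

  starRight-added : ∀ S {w A B u v z} (p : (w ∶ A ✶ B) ∈ Δ S) (r : ⟨ u , v ▷ z ⟩ ∈ G S) → E⊢ (G S) z w →
                    added (starRight S p (just (_ , r))) ≡ add [] [] ((u ∶ A) ∷ [])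
                  ⊎ added (starRight S p (just (_ , r))) ≡ add [] [] ((v ∶ B) ∷ [])
  starRight-added S {w} {z = z} p r z=w with em {E⊢ (G S) z w}
  ... | yes _ = twoRule-added S _ _ _
  ... | no z≠w = ⊥-elim (z≠w z=w)

  axiomRule-added : ∀ S ax (p : ax ∈ Fr) θ → Applicable (G S) ax θ →
                    added (axiomRule S ax p θ)
                      ≡ add (map (instC θ (λ i → freshLabel S (toℕ i))) (FrameAxiom.cons ax)) [] []
  axiomRule-added S ax p θ applicable with em {Applicable (G S) ax θ}
  ... | yes _ = refl
  ... | no inapplicable = ⊥-elim (inapplicable applicable)

  module Chain (S₀ : Seq) (S₀-underivable : ¬ Derivable S₀) where

    stage : ℕ → Seq
    stage zero = S₀
    stage (suc n) = stage n ⊕ added (perform (schedule n) (stage n))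

    underivable : ∀ n → ¬ Derivable (stage n)
    underivable zero = S₀-underivable
    underivable (suc n) = underivable n ∘ reflect (perform (schedule n) (stage n))

    stage-mono : ∀ {k n} → k ≤ n → stage k ≼ stage n
    stage-mono = grow ∘ ≤⇒≤′
      where
      grow : ∀ {k n} → k ≤′ n → stage k ≼ stage n
      grow ≤′-refl = ≼-refl
      grow (≤′-step le) = ≼-trans (grow le) (_ , refl)

    record Performs (n : ℕ) (a : Addition) : Set where
      constructor performing
      field next-stage : stage (suc n) ≡ stage n ⊕ a

    performed-late : ∀ t k₀ → Σ ℕ λ n → k₀ ≤ n × Performs n (added (perform t (stage n)))
    performed-late t k₀ with schedule-fair t k₀
    ... | n , k₀≤n , refl = n , k₀≤n , performing refl

    InG : RelAtom → Set
    InG r = Eventually (λ n → r ∈ G (stage n))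

    InΓ InΔ : LFormula → Set
    InΓ φ = Eventually (λ n → φ ∈ Γ (stage n))
    InΔ φ = Eventually (λ n → φ ∈ Δ (stage n))

    _~_ : Label → Label → Set
    a ~ b = Eventually (λ n → E⊢ (G (stage n)) a b)

    monoG : ∀ {r} → Monotone (λ n → r ∈ G (stage n))
    monoG le = ≼-G (stage-mono le)

    monoΓ : ∀ {φ} → Monotone (λ n → φ ∈ Γ (stage n))
    monoΓ le = ≼-Γ (stage-mono le)

    monoΔ : ∀ {φ} → Monotone (λ n → φ ∈ Δ (stage n))
    monoΔ le = ≼-Δ (stage-mono le)

    monoE : ∀ {a b} → Monotone (λ n → E⊢ (G (stage n)) a b)
    monoE le = E⊢-mono (monoG le)

    ~-refl : ∀ {a} → a ~ a
    ~-refl = 0 , refl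

    ~-sym : ∀ {a b} → a ~ b → b ~ a
    ~-sym (n , e) = n , sym e

    ~-trans : ∀ {a b c} → a ~ b → b ~ c → a ~ c
    ~-trans p q with eventually-both monoE monoE p q
    ... | n , e , e′ = n , trans e e′

    addedG : ∀ {n a r} → Performs n a → r ∈ newG a → InG r
    addedG {n} {a} (performing e) p = suc n , subst (λ T → _ ∈ G T) (≡-sym e) (∈-++⁺ʳ (G (stage n)) p)

    addedΓ : ∀ {n a φ} → Performs n a → φ ∈ newΓ a → InΓ φ
    addedΓ {n} {a} (performing e) p = suc n , subst (λ T → _ ∈ Γ T) (≡-sym e) (∈-++⁺ʳ (Γ (stage n)) p)

    addedΔ : ∀ {n a φ} → Performs n a → φ ∈ newΔ a → InΔ φ
    addedΔ {n} {a} (performing e) p = suc n , subst (λ T → _ ∈ Δ T) (≡-sym e) (∈-++⁺ʳ (Δ (stage n)) p)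

    left-fair : ∀ {φ} k₀ → φ ∈ Γ (stage k₀) → (j : ℕ) →
                Σ ℕ λ n → k₀ ≤ n × Σ (φ ∈ Γ (stage n)) λ p → Performs n (added (leftRule (stage n) φ p j))
    left-fair {φ} k₀ p₀ j with ∈⇒At p₀
    ... | i , at₀ with performed-late (onLeft i j) k₀
    ... | n , k₀≤n , performs with ≼-AtΓ (stage-mono k₀≤n) at₀
    ... | p , at rewrite at = n , k₀≤n , p , performs

    right-fair : ∀ {φ} k₀ → φ ∈ Δ (stage k₀) → (j : ℕ) →
                 Σ ℕ λ n → k₀ ≤ n × Σ (φ ∈ Δ (stage n)) λ p → Performs n (added (rightRule (stage n) φ p j))
    right-fair {φ} k₀ p₀ j with ∈⇒At p₀
    ... | i , at₀ with performed-late (onRight i j) k₀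
    ... | n , k₀≤n , performs with ≼-AtΔ (stage-mono k₀≤n) at₀
    ... | p , at rewrite at = n , k₀≤n , p , performs

    performs-either : ∀ {n a a₁ a₂} → Performs n a → a ≡ a₁ ⊎ a ≡ a₂ → Performs n a₁ ⊎ Performs n a₂
    performs-either e (inj₁ refl) = inj₁ e
    performs-either e (inj₂ refl) = inj₂ e

    -- Saturation: the limit is closed under every backward rule, in the
    -- sense that some premise of each applicable rule is contained in it.
    -- Later arguments use only the statements, so the proofs are opaque
    -- (which also keeps type checking of the truth lemma cheap).
    opaque
      sat-⊤*L : ∀ {a} → InΓ (a ∶ ⊤*) → InG (a ≐ ε)
      sat-⊤*L (k , p) with left-fair k p 0
      ... | _ , _ , _ , performs = addedG performs (here refl)

      sat-∧L : ∀ {a A B} → InΓ (a ∶ A ∧ B) → InΓ (a ∶ A) × InΓ (a ∶ B)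
      sat-∧L (k , p) with left-fair k p 0
      ... | _ , _ , _ , performs = addedΓ performs (here refl) , addedΓ performs (there (here refl))

      sat-⇒L : ∀ {a A B} → InΓ (a ∶ A ⇒ B) → InΔ (a ∶ A) ⊎ InΓ (a ∶ B)
      sat-⇒L (k , p) with left-fair k p 0
      ... | n , _ , _ , performs with performs-either performs (twoRule-added (stage n) _ _ _)
      ... | inj₁ premise₁ = inj₁ (addedΔ premise₁ (here refl))
      ... | inj₂ premise₂ = inj₂ (addedΓ premise₂ (here refl))

      sat-✶L : ∀ {z A B} → InΓ (z ∶ A ✶ B) →
               Σ Label λ u → Σ Label λ v → InG ⟨ u , v ▷ z ⟩ × InΓ (u ∶ A) × InΓ (v ∶ B)
      sat-✶L (k , p) with left-fair k p 0
      ... | _ , _ , _ , performs =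
        _ , _ , addedG performs (here refl) , addedΓ performs (here refl) , addedΓ performs (there (here refl))

      sat--✶L : ∀ {z A B u w v} → InΓ (z ∶ A -✶ B) → InG ⟨ u , w ▷ v ⟩ → z ~ w → InΔ (u ∶ A) ⊎ InΓ (v ∶ B)
      sat--✶L p r z=w with eventually-both monoΓ (monotone-× monoG monoE) p (eventually-both monoG monoE r z=w)
      ... | k , p , r , z=w with ∈⇒At r
      ... | j , at₀ with left-fair k p j
      ... | n , k≤n , q , performs with ≼-AtG (stage-mono k≤n) at₀
      ... | r′ , at rewrite at
          with performs-either performs (wandLeft-added (stage n) q r′ (monoE k≤n z=w))
      ... | inj₁ premise₁ = inj₁ (addedΔ premise₁ (here refl))
      ... | inj₂ premise₂ = inj₂ (addedΓ premise₂ (here refl))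

      sat-∧R : ∀ {a A B} → InΔ (a ∶ A ∧ B) → InΔ (a ∶ A) ⊎ InΔ (a ∶ B)
      sat-∧R (k , p) with right-fair k p 0
      ... | n , _ , _ , performs with performs-either performs (twoRule-added (stage n) _ _ _)
      ... | inj₁ premise₁ = inj₁ (addedΔ premise₁ (here refl))
      ... | inj₂ premise₂ = inj₂ (addedΔ premise₂ (here refl))

      sat-⇒R : ∀ {a A B} → InΔ (a ∶ A ⇒ B) → InΓ (a ∶ A) × InΔ (a ∶ B)
      sat-⇒R (k , p) with right-fair k p 0
      ... | _ , _ , _ , performs = addedΓ performs (here refl) , addedΔ performs (here refl)

      sat-✶R : ∀ {w A B u v z} → InΔ (w ∶ A ✶ B) → InG ⟨ u , v ▷ z ⟩ → z ~ w → InΔ (u ∶ A) ⊎ InΔ (v ∶ B)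
      sat-✶R p r z=w with eventually-both monoΔ (monotone-× monoG monoE) p (eventually-both monoG monoE r z=w)
      ... | k , p , r , z=w with ∈⇒At r
      ... | j , at₀ with right-fair k p j
      ... | n , k≤n , q , performs with ≼-AtG (stage-mono k≤n) at₀
      ... | r′ , at rewrite at
          with performs-either performs (starRight-added (stage n) q r′ (monoE k≤n z=w))
      ... | inj₁ premise₁ = inj₁ (addedΔ premise₁ (here refl))
      ... | inj₂ premise₂ = inj₂ (addedΔ premise₂ (here refl))

      sat--✶R : ∀ {z A B} → InΔ (z ∶ A -✶ B) →
                Σ Label λ u → Σ Label λ v → InG ⟨ u , z ▷ v ⟩ × InΓ (u ∶ A) × InΔ (v ∶ B)
      sat--✶R (k , p) with right-fair k p 0
      ... | _ , _ , _ , performs =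
        _ , _ , addedG performs (here refl) , addedΓ performs (here refl) , addedΔ performs (here refl)

      sat-EM : ∀ a b → InG (a ≐ b) ⊎ InG (a ≭ b)
      sat-EM a b with performed-late (splitEq a b) 0
      ... | n , _ , performs with performs-either performs (twoRule-added (stage n) _ _ _)
      ... | inj₁ premise₁ = inj₁ (addedG premise₁ (here refl))
      ... | inj₂ premise₂ = inj₂ (addedG premise₂ (here refl))

      axiom-performed : ∀ {n ax} (p : ax ∈ Fr) {θ θ′} → (∀ i → θ′ i ≡ θ i) →
                        Applicable (G (stage n)) ax θ′ → Performs n (added (axiomRule (stage n) ax p θ′)) →
                        All (λ C → InG (instC θ (λ i → freshLabel (stage n) (toℕ i)) C)) (FrameAxiom.cons ax)
      axiom-performed {n} {ax} p {θ} {θ′} θ′≗θ applicable performs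
        rewrite axiomRule-added (stage n) ax p θ′ applicable =
        All.tabulate (λ {C} C∈cons → addedG performs (subst (_∈ map (instC θ′ σ) cons) (instC-ext θ′≗θ C)
                                                             (∈-map⁺ (instC θ′ σ) C∈cons)))
        where
        open FrameAxiom ax using (cons)
        σ : Fin (FrameAxiom.n ax) → Label
        σ i = freshLabel (stage n) (toℕ i)

      sat-axiom : ∀ {ax} → ax ∈ Fr → (θ : Fin (FrameAxiom.m ax) → Label) →
                  Eventually (λ n → Applicable (G (stage n)) ax θ) →
                  Σ (Fin (FrameAxiom.n ax) → Label) λ σ → All (λ C → InG (instC θ σ C)) (FrameAxiom.cons ax)
      sat-axiom {ax} ax∈Fr θ (k , applicable) with ∈⇒At ax∈Fr
      ... | i , p , at with performed-late (useAxiom i (encodeTuple (FrameAxiom.m ax) θ)) k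
      ... | n , k≤n , performs rewrite at =
        _ , axiom-performed p decoded
              (applicable-ext ax {σ = λ _ → ε} {λ _ → ε} (≡-sym ∘ decoded)
                              (Applicable-mono ax (monoG k≤n) applicable))
              performs
        where
        decoded : ∀ i → decodeTuple (FrameAxiom.m ax) (encodeTuple (FrameAxiom.m ax) θ) i ≡ θ i
        decoded = decode-encode (FrameAxiom.m ax) θ

      -- Finitely many facts of the limit hold at a common stage, which is
      -- underivable: the limit contains no instance of a zero-premise rule.
      no-id : ∀ {a b p} → InΓ (a ∶ var p) → InΔ (b ∶ var p) → a ~ b → ⊥
      no-id l r a=b with eventually-both monoΓ (monotone-× monoΔ monoE) l (eventually-both monoΔ monoE r a=b)
      ... | n , l , r , a=b = underivable n (contractL l (contractR r (id a=b)))

      no-⊥L : ∀ {a} → InΓ (a ∶ ⊥ᶠ) → ⊥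
      no-⊥L (n , l) = underivable n (contractL l ⊥L)

      no-⊤R : ∀ {a} → InΔ (a ∶ ⊤ᶠ) → ⊥
      no-⊤R (n , r) = underivable n (contractR r ⊤R)

      no-⊤*R : ∀ {a} → InΔ (a ∶ ⊤*) → a ~ ε → ⊥
      no-⊤*R r a=ε with eventually-both monoΔ monoE r a=ε
      ... | n , r , a=ε = underivable n (contractR r (⊤*R a=ε))

      no-NEq : ∀ {a b} → InG (a ≭ b) → a ~ b → ⊥
      no-NEq r a=b with eventually-both monoG monoE r a=b
      ... | n , r , a=b = underivable n (NEq r a=b)

    ~-from-limit : ∀ {a b} → InG (a ≐ b) → a ~ b
    ~-from-limit (n , p) = n , base p

    -- The worlds of the counter-model are the labels modulo ~, each class
    -- represented by its least element (found by excluded middle, hence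
    -- opaque: only the properties below are used).
    opaque
      rep : Label → Label
      rep a = leastUpTo (λ b → em {b ~ a}) a

      rep-≤ : ∀ a → rep a ≤ a
      rep-≤ a = leastUpTo-≤ (λ b → em {b ~ a}) a

      rep~ : ∀ a → rep a ~ a
      rep~ a = proj₁ (leastUpTo-least (λ b → em {b ~ a}) a a ≤-refl ~-refl)

      rep-least : ∀ {a b} → b ≤ a → b ~ a → rep a ≤ b
      rep-least {a} {b} b≤a b~a = proj₂ (leastUpTo-least (λ b → em {b ~ a}) a b b≤a b~a)

      rep-cong-≤ : ∀ {a a′} → a ≤ a′ → a ~ a′ → rep a ≡ rep a′
      rep-cong-≤ {a} {a′} a≤a′ a~a′ = ≤-antisym below above
        where
        above : rep a′ ≤ rep a
        above = rep-least (≤-trans (rep-≤ a) a≤a′) (~-trans (rep~ a) a~a′)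
        below : rep a ≤ rep a′
        below = rep-least (≤-trans above (rep-≤ a)) (~-trans (rep~ a′) (~-sym a~a′))

      rep-cong : ∀ {a a′} → a ~ a′ → rep a ≡ rep a′
      rep-cong {a} {a′} a~a′ with ≤-total a a′
      ... | inj₁ a≤a′ = rep-cong-≤ a≤a′ a~a′
      ... | inj₂ a′≤a = ≡-sym (rep-cong-≤ a′≤a (~-sym a~a′))

    World : Set
    World = Σ Label λ a → rep a ≡ a

    opaque
      [_] : Label → World
      [ a ] = rep a , rep-cong (rep~ a)

      world-≡ : {h h′ : World} → proj₁ h ≡ proj₁ h′ → h ≡ h′
      world-≡ {a , p} {.a , q} refl = cong (a ,_) (≡-irrelevant p q)

      class-sound : ∀ {a b} → a ~ b → [ a ] ≡ [ b ]
      class-sound a~b = world-≡ (rep-cong a~b)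

      class-exact : ∀ {a b} → [ a ] ≡ [ b ] → a ~ b
      class-exact {a} {b} e = ~-trans (~-sym (rep~ a)) (subst (_~ b) (≡-sym (cong proj₁ e)) (rep~ b))

      class-rep : (h : World) → [ proj₁ h ] ≡ h
      class-rep (a , p) = world-≡ p

    Related : World → World → World → Set
    Related h₁ h₂ h₃ = Σ Label λ a → Σ Label λ b → Σ Label λ c →
                       InG ⟨ a , b ▷ c ⟩ × [ a ] ≡ h₁ × [ b ] ≡ h₂ × [ c ] ≡ h₃

    canonicalFrame : Frame
    canonicalFrame = record { H = World ; R = Related ; εH = [ ε ] }

    canonicalModel : Model
    canonicalModel = record
      { frame = canonicalFrame
      ; v = λ p h → Σ Label λ a → InΓ (a ∶ var p) × [ a ] ≡ h }

    _⊨_ : World → Formula → Set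
    h ⊨ A = _⊩_ canonicalModel h A

    mutual
      forced-left : ∀ A a → InΓ (a ∶ A) → [ a ] ⊨ A
      forced-left (var p) a l = a , l , refl
      forced-left ⊤ᶠ a _ = tt
      forced-left ⊥ᶠ a l = ⊥-elim (no-⊥L l)
      forced-left ⊤* a l = class-sound (~-from-limit (sat-⊤*L l))
      forced-left (A ∧ B) a l = forced-left A a (proj₁ (sat-∧L l)) , forced-left B a (proj₂ (sat-∧L l))
      forced-left (A ⇒ B) a l fA with sat-⇒L l
      ... | inj₁ rA = ⊥-elim (refuted-right A a rA fA)
      ... | inj₂ lB = forced-left B a lB
      forced-left (A ✶ B) a l with sat-✶L l
      ... | u , v , r , lA , lB =
        [ u ] , [ v ] , (u , v , a , r , refl , refl , refl) , forced-left A u lA , forced-left B v lB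
      forced-left (A -✶ B) a l _ _ (u , w , v , r , refl , [w]≡[a] , refl) fA
        with sat--✶L l r (class-exact (≡-sym [w]≡[a]))
      ... | inj₁ rA = ⊥-elim (refuted-right A u rA fA)
      ... | inj₂ lB = forced-left B v lB

      refuted-right : ∀ A a → InΔ (a ∶ A) → ¬ ([ a ] ⊨ A)
      refuted-right (var p) a r (b , l , [b]≡[a]) = no-id l r (class-exact [b]≡[a])
      refuted-right ⊤ᶠ a r _ = no-⊤R r
      refuted-right ⊥ᶠ a r ()
      refuted-right ⊤* a r [a]≡[ε] = no-⊤*R r (class-exact [a]≡[ε])
      refuted-right (A ∧ B) a r (fA , fB) with sat-∧R r
      ... | inj₁ rA = refuted-right A a rA fA
      ... | inj₂ rB = refuted-right B a rB fB
      refuted-right (A ⇒ B) a r f with sat-⇒R r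
      ... | lA , rB = refuted-right B a rB (f (forced-left A a lA))
      refuted-right (A ✶ B) a r (_ , _ , (u , v , z , rel , refl , refl , [z]≡[a]) , fA , fB)
        with sat-✶R r rel (class-exact [z]≡[a])
      ... | inj₁ rA = refuted-right A u rA fA
      ... | inj₂ rB = refuted-right B v rB fB
      refuted-right (A -✶ B) a r f with sat--✶R r
      ... | u , v , rel , lA , rB =
        refuted-right B v rB (f [ u ] [ v ] (u , a , v , rel , refl , refl , refl) (forced-left A u lA))

    TriRealised : ∀ {m} → (Fin m → Label) → Ante m → Set
    TriRealised θ (tri u v w) = InG ⟨ θ u , θ v ▷ θ w ⟩
    TriRealised θ (neq _ _) = ⊤

    realised-agree : ∀ {m} {θ θ′ : Fin m → Label} (as : List (Ante m)) →
                     (∀ {i} → i ∈ concatMap anteVars as → θ′ i ≡ θ i) →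
                     All (TriRealised θ′) as → All (TriRealised θ) as
    realised-agree [] _ [] = []
    realised-agree (tri u v w ∷ as) agree (r ∷ rs) =
      subst InG (▷-cong (agree (here refl)) (agree (there (here refl))) (agree (there (there (here refl))))) r
      ∷ realised-agree as (agree ∘ there ∘ there ∘ there) rs
    realised-agree (neq s t ∷ as) agree (_ ∷ rs) =
      tt ∷ realised-agree as (agree ∘ ∈-++⁺ʳ (xtVars s ++ xtVars t)) rs

    -- This is where
    -- linearity is used: each variable occurs in one atom only, so the
    -- labels witnessing different atoms can be chosen independently.
    realise : ∀ {m} (ρ : Fin m → World) (as : List (Ante m)) → Unique (concatMap anteVars as) →
              All (holdsA canonicalFrame ρ) as →
              Σ (Fin m → Label) λ θ → (∀ i → [ θ i ] ≡ ρ i) × All (TriRealised θ) as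
    realise ρ [] _ [] = (λ i → proj₁ (ρ i)) , (λ i → class-rep (ρ i)) , []
    realise ρ (neq s t ∷ as) distinct (_ ∷ hs) with realise ρ as (unique-drop (xtVars s ++ xtVars t) distinct) hs
    ... | θ , θ-ok , rs = θ , θ-ok , tt ∷ rs
    realise ρ (tri u v w ∷ as) ((u≢v ∷ u≢w ∷ u∉as) ∷ (v≢w ∷ v∉as) ∷ w∉as ∷ distinct)
              ((a , b , c , r , [a] , [b] , [c]) ∷ hs) with realise ρ as distinct hs
    ... | θ′ , θ′-ok , rs = θ , θ-ok , subst InG (▷-cong (≡-sym θu) (≡-sym θv) (≡-sym θw)) r ∷ realised-agree as agree rs
      where
      θ = update (update (update θ′ w c) v b) u a
      θ-ok : ∀ i → [ θ i ] ≡ ρ i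
      θ-ok = update-preserves P _ (update-preserves P _ (update-preserves P _ θ′-ok [c]) [b]) [a]
        where
        P : _ → Label → Set
        P i l = [ l ] ≡ ρ i
      θu : θ u ≡ a
      θu = update-hit _ u a
      θv : θ v ≡ b
      θv = ≡-trans (update-miss _ a (u≢v ∘ ≡-sym)) (update-hit _ v b)
      θw : θ w ≡ c
      θw = ≡-trans (update-miss _ a (u≢w ∘ ≡-sym)) (≡-trans (update-miss _ b (v≢w ∘ ≡-sym)) (update-hit _ w c))
      agree : ∀ {i} → i ∈ concatMap anteVars as → θ′ i ≡ θ i
      agree i∈as = ≡-sym (≡-trans (update-miss _ a (All.lookup u∉as i∈as ∘ ≡-sym))
                         (≡-trans (update-miss _ b (All.lookup v∉as i∈as ∘ ≡-sym))
                                  (update-miss _ c (All.lookup w∉as i∈as ∘ ≡-sym))))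

    -- Once the universal variables are realised by θ, the disequational
    -- antecedents follow by EM in the limit, the consequents put in the
    -- limit by the axiom rule hold in the canonical frame.
    module _ {m : ℕ} (ρ : Fin m → World) {θ : Fin m → Label} (θ-ok : ∀ i → [ θ i ] ≡ ρ i) where
      classX : ∀ {n} {σ : Fin n → Label} s → [ instX θ σ s ] ≡ ⟦_⟧x canonicalFrame ρ s
      classX (xᵗ i) = θ-ok i
      classX eps = refl

      antecedent-in-limit : ∀ {n} {σ : Fin n → Label} S → TriRealised θ S →
                            holdsA canonicalFrame ρ S → InG (instA θ σ S)
      antecedent-in-limit (tri u v w) r _ = r
      antecedent-in-limit {σ = σ} (neq s t) _ ρs≢ρt with sat-EM (instX θ σ s) (instX θ σ t)
      ... | inj₁ s=t = ⊥-elim (ρs≢ρt (≡-trans (≡-sym (classX {σ = σ} s))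
                                  (≡-trans (class-sound (~-from-limit s=t)) (classX {σ = σ} t))))
      ... | inj₂ s≠t = s≠t

      equation-in-limit : ∀ {n} {σ : Fin n → Label} s t →
                          ⟦_⟧x canonicalFrame ρ s ≡ ⟦_⟧x canonicalFrame ρ t → instX θ σ s ~ instX θ σ t
      equation-in-limit {σ = σ} s t e =
        class-exact (≡-trans (classX {σ = σ} s) (≡-trans e (≡-sym (classX {σ = σ} t))))

      module _ {n : ℕ} (σ : Fin n → Label) where
        τ : Fin n → World
        τ j = [ σ j ]

        classY : ∀ e → [ instY θ σ e ] ≡ ⟦_⟧y canonicalFrame ρ τ e
        classY (xᵗ i) = θ-ok i
        classY (yᵗ j) = refl
        classY eps = refl

        consequent-holds : ∀ C → InG (instC θ σ C) → holdsC canonicalFrame ρ τ C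
        consequent-holds (tri a b c) r = _ , _ , _ , r , classY a , classY b , classY c
        consequent-holds (eq a b) r = ≡-trans (≡-sym (classY a)) (≡-trans (class-sound (~-from-limit r)) (classY b))
        consequent-holds (neq a b) r ρa≡ρb = no-NEq r (class-exact (≡-trans (classY a) (≡-trans ρa≡ρb (≡-sym (classY b)))))

    satisfies : ∀ {ax} → ax ∈ Fr → Satisfies canonicalFrame ax
    satisfies {ax} ax∈Fr ρ equations antecedents with realise ρ ante linear antecedents
      where open FrameAxiom ax
    ... | θ , θ-ok , realised with sat-axiom ax∈Fr θ applicable
      where
      open FrameAxiom ax
      noY : Fin n → Label
      noY _ = ε
      applicable : Eventually (λ k → Applicable (G (stage k)) ax θ)
      applicable = eventually-both (λ le → All.map (monoG le)) (λ le → All.map (monoE le))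
        (eventually-all {P = λ S k → instA θ noY S ∈ G (stage k)} monoG
           (All.zipWith (λ {S} (r , h) → antecedent-in-limit ρ θ-ok {σ = noY} S r h) (realised , antecedents)))
        (eventually-all {P = λ st k → E⊢ (G (stage k)) (instX θ noY (proj₁ st)) (instX θ noY (proj₂ st))} monoE
           (All.map (λ {st} → equation-in-limit ρ θ-ok {σ = noY} (proj₁ st) (proj₂ st)) equations))
    ... | σ , consequents = τ ρ θ-ok σ , All.map (λ {C} → consequent-holds ρ θ-ok σ C) consequents

    satisfies-all : All (Satisfies canonicalFrame) Fr
    satisfies-all = All.tabulate satisfies

theorem3p11 : ExcludedMiddle 0ℓ →
    (Fr : List FrameAxiom) (F : Formula) (w : Label) → w ≢ ε →
    ¬ Der Fr [] [] ((w ∶ F) ∷ []) →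
    ¬ Valid Fr F
theorem3p11 em Fr F w _ underivable valid =
  refuted-right F w (0 , here refl) (valid canonicalModel satisfies-all [ w ])
  where
  open Construction em Fr
  open Chain (sq [] [] ((w ∶ F) ∷ [])) underivable
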